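{- Let $p\ge2$, $n\ge1$ be integers and $\alpha\in(0,1/2]$ with $\alpha n$ an integer. Let $G$ be a uniformly random $\alpha$-partial matching on $\{1,\dots,n\}$ and let $M\in\{0,1\}^{\alpha n\times n}$ be its incidence matrix. If $x \in \mathbb{Z}_p^n$ has $|x|=k$ for some even $k$, then $$\Pr_G\left[\exists z \in \mathbb{Z}_p^{\alpha n} \text{ such that } M^T z = x\right] \le \binom{\alpha n}{k/2} \bigg/ \binom{n}{k}.$$
   Context: An $\alpha$-partial matching on $\{1,\dots,n\}$ is a matching with exactly $\alpha n$ edges on vertex set $\{1,\dots,n\}$; "uniformly random" means uniform over all such matchings. Its incidence matrix $M\in\{0,1\}^{\alpha n\times n}$ has $M_{ev}=1$ iff vertex $v$ is an endpoint of edge $e$. Arithmetic is in $\mathbb{Z}_p$ (integers modulo $p$). $|x|$ is the number of nonzero coordinates of $x$. -}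

module Defs where

open import Data.Bool using (Bool; true; false; _∧_; not; T)
open import Data.Nat using (ℕ; zero; suc; _+_; _<ᵇ_; _≡ᵇ_; NonZero)
open import Data.Nat.DivMod using (_mod_)
open import Data.Fin using (Fin; toℕ)
open import Data.Fin.Properties using () renaming (_≟_ to _≟ᶠ_)
open import Data.Product using (_×_; _,_; proj₁; proj₂)
open import Data.List using (List; []; _∷_; length; filterᵇ; allFin; cartesianProduct; map; concatMap; filter)
open import Data.Bool.ListAction using (any)
open import Data.Vec using (Vec; []; _∷_; toList; tabulate; foldr; zipWith)
open import Data.Vec.Properties using () renaming (≡-dec to ≡-decᵛ)
open import Data.List.Relation.Unary.Any using (Any; any?)
open import Relation.Nullary.Decidable using (isYes; Dec)
open import Relation.Binary.PropositionalEquality using (_≡_)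

-- Z_p is represented as Fin p, with addition modulo p.
_+ₚ_ : ∀ {p} .{{_ : NonZero p}} → Fin p → Fin p → Fin p
_+ₚ_ {p} a b = (toℕ a + toℕ b) mod p

0ₚ : ∀ {p} .{{_ : NonZero p}} → Fin p
0ₚ {p} = 0 mod p

weight : ∀ {p n} → Vec (Fin p) n → ℕ
weight x = length (filterᵇ (λ a → not (toℕ a ≡ᵇ 0)) (toList x))

-- An edge is an (ordered) pair of vertices of {1..n} = Fin n.
Edge : ℕ → Set
Edge n = Fin n × Fin n

allVecs : {A : Set} → List A → (m : ℕ) → List (Vec A m)
allVecs xs zero = [] ∷ []
allVecs xs (suc m) = concatMap (λ a → map (a ∷_) (allVecs xs m)) xs

allDistinct : List ℕ → Bool
allDistinct [] = true
allDistinct (x ∷ xs) = not (any (λ y → x ≡ᵇ y) xs) ∧ allDistinct xs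

endpoints : ∀ {n m} → Vec (Edge n) m → List ℕ
endpoints [] = []
endpoints ((u , v) ∷ es) = toℕ u ∷ toℕ v ∷ endpoints es

orientedOK : ∀ {n m} → Vec (Edge n) m → Bool
orientedOK [] = true
orientedOK ((u , v) ∷ es) = (toℕ u <ᵇ toℕ v) ∧ orientedOK es

sortedOK : ∀ {n m} → Vec (Edge n) m → Bool
sortedOK [] = true
sortedOK (e ∷ []) = true
sortedOK (e ∷ f ∷ es) = (toℕ (proj₁ e) <ᵇ toℕ (proj₁ f)) ∧ sortedOK (f ∷ es)

-- Canonical representation of a matching with exactly m edges on Fin n:
-- m vertex-disjoint edges {u,v}, u<v, listed in increasing order of u.
-- Each matching (set of m disjoint edges) has exactly one canonical representation.
isMatching : ∀ {n m} → Vec (Edge n) m → Bool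
isMatching es = allDistinct (endpoints es) ∧ orientedOK es ∧ sortedOK es

matchings : (n m : ℕ) → List (Vec (Edge n) m)
matchings n m = filterᵇ isMatching (allVecs (cartesianProduct (allFin n) (allFin n)) m)

incident : ∀ {n} → Edge n → Fin n → Bool
incident (u , w) v = isYes (u ≟ᶠ v) Data.Bool.∨ isYes (w ≟ᶠ v)

Mᵀ* : ∀ {p n m} .{{_ : NonZero p}} → Vec (Edge n) m → Vec (Fin p) m → Vec (Fin p) n
Mᵀ* es z = tabulate λ v →
  foldr _ _+ₚ_ 0ₚ (zipWith (λ e ze → Data.Bool.if incident e v then ze else 0ₚ) es z)

Solvable : ∀ {p n m} .{{_ : NonZero p}} → Vec (Fin p) n → Vec (Edge n) m → Set
Solvable {p} {n} {m} x es = Any (λ z → Mᵀ* es z ≡ x) (allVecs (allFin p) m)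

solvable? : ∀ {p n m} .{{_ : NonZero p}} (x : Vec (Fin p) n) (es : Vec (Edge n) m) → Dec (Solvable x es)
solvable? {p} {n} {m} x es = any? (λ z → ≡-decᵛ _≟ᶠ_ (Mᵀ* es z) x) (allVecs (allFin p) m)

goodCount : ∀ {p} .{{_ : NonZero p}} (n m : ℕ) → Vec (Fin p) n → ℕ
goodCount n m x = length (filter (solvable? x) (matchings n m))

totalCount : (n m : ℕ) → ℕ
totalCount n m = length (matchings n m)

module Submission where

-- Idea.  Let S be the support of x.  Each edge e of a matching contributes z_e to
-- both of its endpoints and nothing elsewhere, so if Mᵀz = x then every edge lies
-- inside S or inside its complement, and every vertex of S is covered.  Such
-- S-compatible matchings are a perfect matching of S together with an
-- (m-j)-matching of the other n-2j vertices: there are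
-- compat n j m = (2j-1)!!·μ(n-2j, m-j) of them, μ(a, b) being the number of
-- b-edge matchings on a vertices.  Counting pairs (matching, j of its edges) in two
-- ways gives compat n j m · C(n, 2j) = C(m, j) · μ(n, m), and μ(n, m) is the total.

open import Defs
open import Data.Nat using (ℕ; _+_; _*_; _≤_; _<_; NonZero)
open import Data.Nat.Combinatorics using (_C_)
open import Data.Fin using (Fin)
open import Data.Vec using (Vec)
open import Relation.Binary.PropositionalEquality using (_≡_)

module MatchingNumbers where

  open import Data.Nat
  open import Data.Nat.Properties
  open import Data.Nat.Tactic.RingSolver using (solve-∀)
  open import Data.Nat.Combinatorics using (_C_; nCk+nC[k+1]≡[n+1]C[k+1])
  open import Relation.Binary.PropositionalEquality
  open ≡-Reasoning

  -- Binomial coefficients by Pascal's rule: structural recursion makes the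
  -- absorption identities below provable by plain induction.
  binom : ℕ → ℕ → ℕ
  binom n zero = 1
  binom zero (suc k) = 0
  binom (suc n) (suc k) = binom n k + binom n (suc k)

  binom≡C : ∀ n k → binom n k ≡ n C k
  binom≡C n zero = refl
  binom≡C zero (suc k) = refl
  binom≡C (suc n) (suc k) =
    trans (cong₂ _+_ (binom≡C n k) (binom≡C n (suc k))) (nCk+nC[k+1]≡[n+1]C[k+1] n k)

  binom-1 : ∀ n → binom n 1 ≡ n
  binom-1 zero = refl
  binom-1 (suc n) = cong suc (binom-1 n)

  binom-absorb : ∀ m j → suc j * binom (suc m) (suc j) ≡ suc m * binom m j
  binom-absorb zero zero = refl
  binom-absorb zero (suc j) = *-zeroʳ (suc (suc j))
  binom-absorb (suc m) zero = begin
    1 * (1 + binom (suc m) 1) ≡⟨ *-identityˡ _ ⟩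
    1 + binom (suc m) 1       ≡⟨ cong suc (binom-1 (suc m)) ⟩
    suc (suc m)               ≡⟨ *-identityʳ _ ⟨
    suc (suc m) * 1           ∎
  binom-absorb (suc m) (suc j) = begin
    suc (suc j) * (b₁ + b₂)               ≡⟨ spread j b₁ b₂ ⟩
    b₁ + suc j * b₁ + suc (suc j) * b₂    ≡⟨ cong₂ (λ a b → b₁ + a + b) (binom-absorb m j) (binom-absorb m (suc j)) ⟩
    (c₁ + c₂) + suc m * c₁ + suc m * c₂   ≡⟨ collect m c₁ c₂ ⟩
    suc (suc m) * (c₁ + c₂)               ∎
    where
    b₁ b₂ c₁ c₂ : ℕ
    b₁ = binom (suc m) (suc j)
    b₂ = binom (suc m) (suc (suc j))
    c₁ = binom m j
    c₂ = binom m (suc j)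
    spread : ∀ j u v → suc (suc j) * (u + v) ≡ u + suc j * u + suc (suc j) * v
    spread = solve-∀
    collect : ∀ m p q → (p + q) + suc m * p + suc m * q ≡ suc (suc m) * (p + q)
    collect = solve-∀

  binom-absorb₂ : ∀ c k → suc (suc k) * suc k * binom (suc (suc c)) (suc (suc k))
                        ≡ suc (suc c) * suc c * binom c k
  binom-absorb₂ c k = begin
    suc (suc k) * suc k * binom (suc (suc c)) (suc (suc k))   ≡⟨ reassoc₁ k (binom (suc (suc c)) (suc (suc k))) ⟩
    suc k * (suc (suc k) * binom (suc (suc c)) (suc (suc k))) ≡⟨ cong (suc k *_) (binom-absorb (suc c) (suc k)) ⟩
    suc k * (suc (suc c) * binom (suc c) (suc k))             ≡⟨ reassoc₂ k c (binom (suc c) (suc k)) ⟩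
    suc (suc c) * (suc k * binom (suc c) (suc k))             ≡⟨ cong (suc (suc c) *_) (binom-absorb c k) ⟩
    suc (suc c) * (suc c * binom c k)                         ≡⟨ *-assoc (suc (suc c)) (suc c) _ ⟨
    suc (suc c) * suc c * binom c k                           ∎
    where
    reassoc₁ : ∀ k x → suc (suc k) * suc k * x ≡ suc k * (suc (suc k) * x)
    reassoc₁ = solve-∀
    reassoc₂ : ∀ k c x → suc k * (suc (suc c) * x) ≡ suc (suc c) * (suc k * x)
    reassoc₂ = solve-∀

  -- μ a b is the number of b-edge matchings on a vertices: the last vertex is
  -- either unmatched or matched to one of the other a vertices.
  μ : ℕ → ℕ → ℕ
  μ zero zero = 1
  μ zero (suc b) = 0
  μ (suc a) zero = 1
  μ (suc a) (suc b) = μ a (suc b) + a * μ (a ∸ 1) b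

  μ-empty : ∀ a → μ a 0 ≡ 1
  μ-empty zero = refl
  μ-empty (suc a) = refl

  mutual
    -- Matchings with a marked, oriented edge: 2(b+1)·μ(a, b+1) = a(a-1)·μ(a-2, b).
    μ-marked-edge : ∀ a b → 2 * suc b * μ a (suc b) ≡ a * (a ∸ 1) * μ (a ∸ 2) b
    μ-marked-edge zero b = *-zeroʳ (2 * suc b)
    μ-marked-edge (suc zero) b = *-zeroʳ (2 * suc b)
    μ-marked-edge (suc (suc c)) b = begin
      2 * suc b * (μ (suc c) (suc b) + suc c * μ c b)
        ≡⟨ expand b c (μ (suc c) (suc b)) (μ c b) ⟩
      2 * suc b * μ (suc c) (suc b) + (suc c * (2 * b * μ c b) + 2 * suc c * μ c b)
        ≡⟨ cong (_+ (suc c * (2 * b * μ c b) + 2 * suc c * μ c b)) (μ-marked-edge (suc c) b) ⟩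
      suc c * c * μ (c ∸ 1) b + (suc c * (2 * b * μ c b) + 2 * suc c * μ c b)
        ≡⟨ regroup b c (μ c b) (μ (c ∸ 1) b) ⟩
      suc c * (c * μ (c ∸ 1) b + 2 * b * μ c b) + 2 * suc c * μ c b
        ≡⟨ cong (λ z → suc c * z + 2 * suc c * μ c b) (μ-free-vertex c b) ⟩
      suc c * (c * μ c b) + 2 * suc c * μ c b
        ≡⟨ collect c (μ c b) ⟩
      suc (suc c) * suc c * μ c b ∎
      where
      expand : ∀ b c X Y → 2 * suc b * (X + suc c * Y) ≡ 2 * suc b * X + (suc c * (2 * b * Y) + 2 * suc c * Y)
      expand = solve-∀
      regroup : ∀ b c Y Z → suc c * c * Z + (suc c * (2 * b * Y) + 2 * suc c * Y) ≡ suc c * (c * Z + 2 * b * Y) + 2 * suc c * Y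
      regroup = solve-∀
      collect : ∀ c Y → suc c * (c * Y) + 2 * suc c * Y ≡ suc (suc c) * suc c * Y
      collect = solve-∀

    -- Pairs (vertex, b-matching): the vertex is free, or one of the 2b covered
    -- vertices, so  c·μ(c-1, b) + 2b·μ(c, b) = c·μ(c, b).
    μ-free-vertex : ∀ c b → c * μ (c ∸ 1) b + 2 * b * μ c b ≡ c * μ c b
    μ-free-vertex c zero rewrite μ-empty (c ∸ 1) | μ-empty c = +-identityʳ (c * 1)
    μ-free-vertex zero (suc b) = *-zeroʳ (2 * suc b)
    μ-free-vertex (suc c) (suc b) = begin
      suc c * μ c (suc b) + 2 * suc b * μ (suc c) (suc b)
        ≡⟨ cong (suc c * μ c (suc b) +_) (μ-marked-edge (suc c) b) ⟩
      suc c * μ c (suc b) + suc c * c * μ (c ∸ 1) b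
        ≡⟨ cong (suc c * μ c (suc b) +_) (*-assoc (suc c) c (μ (c ∸ 1) b)) ⟩
      suc c * μ c (suc b) + suc c * (c * μ (c ∸ 1) b)
        ≡⟨ *-distribˡ-+ (suc c) (μ c (suc b)) (c * μ (c ∸ 1) b) ⟨
      suc c * (μ c (suc b) + c * μ (c ∸ 1) b) ∎

  -- compat w j m = (2j-1)!!·μ(w-2j, m-j): the number of m-matchings on w vertices
  -- that match a fixed 2j-set S perfectly within itself and avoid S otherwise.
  compat : ℕ → ℕ → ℕ → ℕ
  compat w zero m = μ w m
  compat w (suc j) zero = 0
  compat w (suc j) (suc m) = suc (2 * j) * compat (w ∸ 2) j m

  compat-empty : ∀ a b j → compat a j 0 ≡ compat b j 0
  compat-empty a b zero rewrite μ-empty a | μ-empty b = refl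
  compat-empty a b (suc j) = refl

  2*suc : ∀ j → 2 * suc j ≡ suc (suc (2 * j))
  2*suc = solve-∀

  -- Adding a vertex outside S: it is either unmatched, or matched to one of the
  -- w-2j other vertices outside S.
  compat-step : ∀ j m w → 2 * j ≤ w →
    compat w j (suc m) + (w ∸ 2 * j) * compat (w ∸ 1) j m ≡ compat (suc w) j (suc m)
  compat-step zero m w le = refl
  compat-step (suc j) m zero le with () ← subst (_≤ 0) (2*suc j) le
  compat-step (suc j) m (suc zero) le with s≤s () ← subst (_≤ 1) (2*suc j) le
  compat-step (suc j) zero (suc (suc w)) le = begin
    suc (2 * j) * compat w j 0 + (suc (suc w) ∸ 2 * suc j) * 0
      ≡⟨ cong (suc (2 * j) * compat w j 0 +_) (*-zeroʳ (suc (suc w) ∸ 2 * suc j)) ⟩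
    suc (2 * j) * compat w j 0 + 0
      ≡⟨ +-identityʳ _ ⟩
    suc (2 * j) * compat w j 0
      ≡⟨ cong (suc (2 * j) *_) (compat-empty w (suc w) j) ⟩
    suc (2 * j) * compat (suc w) j 0 ∎
  compat-step (suc j) (suc m) (suc (suc w)) le = begin
    d * compat w j (suc m) + (suc (suc w) ∸ 2 * suc j) * (d * compat (w ∸ 1) j m)
      ≡⟨ cong (λ z → d * compat w j (suc m) + z * (d * compat (w ∸ 1) j m)) (cong (suc (suc w) ∸_) (2*suc j)) ⟩
    d * compat w j (suc m) + (w ∸ 2 * j) * (d * compat (w ∸ 1) j m)
      ≡⟨ factor d (compat w j (suc m)) (w ∸ 2 * j) (compat (w ∸ 1) j m) ⟩
    d * (compat w j (suc m) + (w ∸ 2 * j) * compat (w ∸ 1) j m)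
      ≡⟨ cong (d *_) (compat-step j m w (≤-pred (≤-pred (subst (_≤ suc (suc w)) (2*suc j) le)))) ⟩
    d * compat (suc w) j (suc m) ∎
    where
    d : ℕ
    d = suc (2 * j)
    factor : ∀ s A x B → s * A + x * (s * B) ≡ s * (A + x * B)
    factor = solve-∀

  -- The two sides of the double-counting identity, each multiplied by 2(j+1),
  -- reduce to the corresponding sides for c = n - 2 vertices and j - 1, m - 1.
  compat-side-shift : ∀ c j m →
    compat (suc (suc c)) (suc j) (suc m) * binom (suc (suc c)) (2 * suc j) * (2 * suc j)
      ≡ suc (suc c) * suc c * (compat c j m * binom c (2 * j))
  compat-side-shift c j m = begin
    d * f * binom (suc (suc c)) (2 * suc j) * (2 * suc j)
      ≡⟨ cong (λ z → d * f * binom (suc (suc c)) z * (2 * suc j)) (2*suc j) ⟩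
    d * f * binom (suc (suc c)) (suc d) * (2 * suc j)
      ≡⟨ reassoc₁ j f (binom (suc (suc c)) (suc d)) ⟩
    f * (suc d * d * binom (suc (suc c)) (suc d))
      ≡⟨ cong (f *_) (binom-absorb₂ c (2 * j)) ⟩
    f * (suc (suc c) * suc c * binom c (2 * j))
      ≡⟨ reassoc₂ f (suc (suc c) * suc c) (binom c (2 * j)) ⟩
    suc (suc c) * suc c * (f * binom c (2 * j)) ∎
    where
    d f : ℕ
    d = suc (2 * j)
    f = compat c j m
    reassoc₁ : ∀ j f β → suc (2 * j) * f * β * (2 * suc j) ≡ f * (suc (suc (2 * j)) * suc (2 * j) * β)
    reassoc₁ = solve-∀
    reassoc₂ : ∀ x y z → x * (y * z) ≡ y * (x * z)
    reassoc₂ = solve-∀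

  μ-side-shift : ∀ c j m →
    suc (suc c) * suc c * (binom m j * μ c m) ≡ binom (suc m) (suc j) * μ (suc (suc c)) (suc m) * (2 * suc j)
  μ-side-shift c j m = begin
    suc (suc c) * suc c * (binom m j * μ c m)
      ≡⟨ reassoc₁ (suc (suc c) * suc c) (binom m j) (μ c m) ⟩
    binom m j * (suc (suc c) * suc c * μ c m)
      ≡⟨ cong (binom m j *_) (μ-marked-edge (suc (suc c)) m) ⟨
    binom m j * (2 * suc m * μ (suc (suc c)) (suc m))
      ≡⟨ reassoc₂ m (binom m j) (μ (suc (suc c)) (suc m)) ⟩
    2 * (suc m * binom m j) * μ (suc (suc c)) (suc m)
      ≡⟨ cong (λ z → 2 * z * μ (suc (suc c)) (suc m)) (binom-absorb m j) ⟨
    2 * (suc j * binom (suc m) (suc j)) * μ (suc (suc c)) (suc m)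
      ≡⟨ reassoc₃ j (binom (suc m) (suc j)) (μ (suc (suc c)) (suc m)) ⟩
    binom (suc m) (suc j) * μ (suc (suc c)) (suc m) * (2 * suc j) ∎
    where
    reassoc₁ : ∀ x y z → x * (y * z) ≡ y * (x * z)
    reassoc₁ = solve-∀
    reassoc₂ : ∀ m b t → b * (2 * suc m * t) ≡ 2 * (suc m * b) * t
    reassoc₂ = solve-∀
    reassoc₃ : ∀ j b t → 2 * (suc j * b) * t ≡ b * t * (2 * suc j)
    reassoc₃ = solve-∀

  -- Double counting pairs (m-matching, j of its edges):
  --   compat n j m · C(n, 2j) = C(m, j) · μ(n, m).
  compat-double-count : ∀ n j m → 2 * j ≤ n → compat n j m * binom n (2 * j) ≡ binom m j * μ n m
  compat-double-count n zero m le = trans (*-identityʳ _) (sym (+-identityʳ _))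
  compat-double-count n (suc j) zero le = refl
  compat-double-count zero (suc j) (suc m) le with () ← subst (_≤ 0) (2*suc j) le
  compat-double-count (suc zero) (suc j) (suc m) le with s≤s () ← subst (_≤ 1) (2*suc j) le
  compat-double-count (suc (suc c)) (suc j) (suc m) le =
    *-cancelʳ-≡ (compat (suc (suc c)) (suc j) (suc m) * binom (suc (suc c)) (2 * suc j))
                (binom (suc m) (suc j) * μ (suc (suc c)) (suc m)) (2 * suc j) (begin
      compat (suc (suc c)) (suc j) (suc m) * binom (suc (suc c)) (2 * suc j) * (2 * suc j)
        ≡⟨ compat-side-shift c j m ⟩
      suc (suc c) * suc c * (compat c j m * binom c (2 * j))
        ≡⟨ cong (suc (suc c) * suc c *_) (compat-double-count c j m 2j≤c) ⟩
      suc (suc c) * suc c * (binom m j * μ c m)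
        ≡⟨ μ-side-shift c j m ⟩
      binom (suc m) (suc j) * μ (suc (suc c)) (suc m) * (2 * suc j) ∎)
    where
    2j≤c : 2 * j ≤ c
    2j≤c = ≤-pred (≤-pred (subst (_≤ suc (suc c)) (2*suc j) le))

module Counting where

  open import Data.Bool using (Bool; true; false; _∧_; _∨_; not; T)
  open import Data.Sum using (_⊎_)
  open import Data.Bool.Properties using (∧-zeroʳ; T-≡; T-not-≡; T-∧; T-∨; ¬-not)
  open import Function.Bundles using (Equivalence)
  open import Data.Nat
  open import Data.Nat.Properties
  open import Data.Fin using (Fin; zero; suc; toℕ)
  open import Data.Fin.Properties using (toℕ-injective) renaming (suc-injective to sucᶠ-injective)
  open import Data.Product using (_×_; _,_; Σ; proj₁; proj₂)
  open import Data.List using (List; []; _∷_; _++_; map; concatMap; filter; filterᵇ; length; cartesianProduct; allFin; tabulate)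
  open import Data.Empty using (⊥-elim)
  open import Data.Unit using (tt)
  open import Function using (_∘_)
  open import Level using (Level)
  open import Relation.Nullary using (¬_; Dec; yes; does)
  open import Relation.Unary using (Pred; Decidable)
  open import Relation.Binary.PropositionalEquality
  open import Algebra.Properties.Semiring.Sum +-*-semiring
    using (sum; sum-cong-≗; ∑-distrib-+; *-distribʳ-sum; sum-replicate-zero)
  open ≡-Reasoning

  T⇒≡true : ∀ {b} → T b → b ≡ true
  T⇒≡true {b} = Equivalence.to (T-≡ {b})

  ≡true⇒T : ∀ {b} → b ≡ true → T b
  ≡true⇒T {b} = Equivalence.from (T-≡ {b})

  T-not⇒≡false : ∀ {b} → T (not b) → b ≡ false
  T-not⇒≡false {b} = Equivalence.to (T-not-≡ {b})

  ¬T⇒≡false : ∀ {b} → ¬ T b → b ≡ false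
  ¬T⇒≡false ¬t = ¬-not (¬t ∘ ≡true⇒T)

  ≡false⇒¬T : ∀ {b} → b ≡ false → ¬ T b
  ≡false⇒¬T refl ()

  T-∧-intro : ∀ {a b} → T a → T b → T (a ∧ b)
  T-∧-intro {a} {b} s t = Equivalence.from (T-∧ {a} {b}) (s , t)

  T-∧-fst : ∀ a {b} → T (a ∧ b) → T a
  T-∧-fst a {b} = proj₁ ∘ Equivalence.to (T-∧ {a} {b})

  T-∧-snd : ∀ a {b} → T (a ∧ b) → T b
  T-∧-snd a {b} = proj₂ ∘ Equivalence.to (T-∧ {a} {b})

  T-∨-elim : ∀ a {b} → T (a ∨ b) → T a ⊎ T b
  T-∨-elim a {b} = Equivalence.to (T-∨ {a} {b})

  T-ext : ∀ {a b} → (T a → T b) → (T b → T a) → a ≡ b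
  T-ext {false} {false} f g = refl
  T-ext {false} {true} f g = ⊥-elim (g tt)
  T-ext {true} {false} f g = ⊥-elim (f tt)
  T-ext {true} {true} f g = refl

  ∧-implied : ∀ a b → (T a → T b) → a ∧ b ≡ a
  ∧-implied false b f = refl
  ∧-implied true b f = T⇒≡true (f tt)

  ∧-cong-under : ∀ c {a b} → (T c → a ≡ b) → c ∧ a ≡ c ∧ b
  ∧-cong-under false f = refl
  ∧-cong-under true f = f tt

  witness : ∀ {P : Set} (d : Dec P) → T (does d) → P
  witness (yes p) _ = p

  ind : Bool → ℕ
  ind true = 1
  ind false = 0

  ind-mono : ∀ {a b} → (T a → T b) → ind a ≤ ind b
  ind-mono {false} f = z≤n
  ind-mono {true} {true} f = ≤-refl
  ind-mono {true} {false} f = ⊥-elim (f tt)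

  ind≤1 : ∀ a → ind a ≤ 1
  ind≤1 false = z≤n
  ind≤1 true = ≤-refl

  sumL : {A : Set} → (A → ℕ) → List A → ℕ
  sumL f [] = 0
  sumL f (x ∷ xs) = f x + sumL f xs

  sumL-cong : {A : Set} {f g : A → ℕ} (xs : List A) → (∀ x → f x ≡ g x) → sumL f xs ≡ sumL g xs
  sumL-cong [] e = refl
  sumL-cong (x ∷ xs) e = cong₂ _+_ (e x) (sumL-cong xs e)

  sumL-++ : {A : Set} (f : A → ℕ) (xs ys : List A) → sumL f (xs ++ ys) ≡ sumL f xs + sumL f ys
  sumL-++ f [] ys = refl
  sumL-++ f (x ∷ xs) ys = trans (cong (f x +_) (sumL-++ f xs ys)) (sym (+-assoc (f x) _ _))

  sumL-map : {A B : Set} (g : B → ℕ) (f : A → B) (xs : List A) → sumL g (map f xs) ≡ sumL (g ∘ f) xs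
  sumL-map g f [] = refl
  sumL-map g f (x ∷ xs) = cong (g (f x) +_) (sumL-map g f xs)

  sumL-concatMap : {A B : Set} (g : B → ℕ) (f : A → List B) (xs : List A) →
    sumL g (concatMap f xs) ≡ sumL (sumL g ∘ f) xs
  sumL-concatMap g f [] = refl
  sumL-concatMap g f (x ∷ xs) = trans (sumL-++ g (f x) (concatMap f xs)) (cong (sumL g (f x) +_) (sumL-concatMap g f xs))

  sumL-cartesian : {A B : Set} (g : A × B → ℕ) (xs : List A) (ys : List B) →
    sumL g (cartesianProduct xs ys) ≡ sumL (λ x → sumL (λ y → g (x , y)) ys) xs
  sumL-cartesian g [] ys = refl
  sumL-cartesian g (x ∷ xs) ys = trans (sumL-++ g (map (x ,_) ys) (cartesianProduct xs ys))
    (cong₂ _+_ (sumL-map g (x ,_) ys) (sumL-cartesian g xs ys))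

  sumL-allFin : ∀ {n} (h : Fin n → ℕ) → sumL h (allFin n) ≡ sum h
  sumL-allFin h = sumL-tabulate h (λ i → i)
    where
    sumL-tabulate : ∀ {n} {A : Set} (h : A → ℕ) (f : Fin n → A) → sumL h (tabulate f) ≡ sum (h ∘ f)
    sumL-tabulate {zero} h f = refl
    sumL-tabulate {suc n} h f = cong (h (f zero) +_) (sumL-tabulate h (f ∘ suc))

  count : {A : Set} → (A → Bool) → List A → ℕ
  count p = sumL (ind ∘ p)

  count-filter : {A : Set} {ℓ : Level} {P : Pred A ℓ} (P? : Decidable P) (xs : List A) →
    length (filter P? xs) ≡ count (λ x → does (P? x)) xs
  count-filter P? [] = refl
  count-filter P? (x ∷ xs) with does (P? x)
  ... | true = cong suc (count-filter P? xs)
  ... | false = count-filter P? xs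

  count-filterᵇ : {A : Set} (p q : A → Bool) (xs : List A) → count p (filterᵇ q xs) ≡ count (λ x → q x ∧ p x) xs
  count-filterᵇ p q [] = refl
  count-filterᵇ p q (x ∷ xs) with q x
  ... | true = cong (ind (p x) +_) (count-filterᵇ p q xs)
  ... | false = count-filterᵇ p q xs

  count-mono : {A : Set} {p q : A → Bool} (xs : List A) → (∀ x → T (p x) → T (q x)) → count p xs ≤ count q xs
  count-mono [] e = z≤n
  count-mono (x ∷ xs) e = +-mono-≤ (ind-mono (e x)) (count-mono xs e)

  count-guard : {A : Set} (b : Bool) (q : A → Bool) (xs : List A) → count (λ x → b ∧ q x) xs ≡ ind b * count q xs
  count-guard true q xs = sym (+-identityʳ _)
  count-guard false q [] = refl
  count-guard false q (x ∷ xs) = count-guard false q xs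

  count-none : {A : Set} (p : A → Bool) (xs : List A) → (∀ x → p x ≡ false) → count p xs ≡ 0
  count-none p [] e = refl
  count-none p (x ∷ xs) e rewrite e x = count-none p xs e

  sum-zero : ∀ {n} (f : Fin n → ℕ) → (∀ u → f u ≡ 0) → sum f ≡ 0
  sum-zero {n} f e = trans (sum-cong-≗ e) (sum-replicate-zero n)

  sum-single-out : ∀ {n} (f g : Fin n → ℕ) (w₀ : Fin n) →
    (∀ u → u ≢ w₀ → f u ≡ g u) → g w₀ ≡ 0 → sum f ≡ sum g + f w₀
  sum-single-out {suc n} f g zero e g0 rewrite g0 =
    trans (+-comm (f zero) _) (cong (_+ f zero) (sum-cong-≗ (λ u → e (suc u) (λ ()))))
  sum-single-out {suc n} f g (suc w) e g0 =
    trans (cong₂ _+_ (e zero (λ ())) (sum-single-out (f ∘ suc) (g ∘ suc) w (λ u ne → e (suc u) (ne ∘ sucᶠ-injective)) g0))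
          (sym (+-assoc (g zero) _ _))

  Sub : ℕ → Set
  Sub n = Fin n → Bool

  size : ∀ {n} → Sub n → ℕ
  size A = sum (ind ∘ A)

  -- Boolean equality of vertices, in the form used by the definition of matchings.
  _==_ : ∀ {n} → Fin n → Fin n → Bool
  a == x = toℕ a ≡ᵇ toℕ x

  ==-refl : ∀ {n} (a : Fin n) → (a == a) ≡ true
  ==-refl a = T⇒≡true (≡⇒≡ᵇ (toℕ a) (toℕ a) refl)

  ==⇒≡ : ∀ {n} {a x : Fin n} → T (a == x) → a ≡ x
  ==⇒≡ {a = a} {x} t = toℕ-injective (≡ᵇ⇒≡ (toℕ a) (toℕ x) t)

  ==-sym : ∀ {n} (a b : Fin n) → (a == b) ≡ (b == a)
  ==-sym a b = T-ext (flip a b) (flip b a)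
    where
    flip : ∀ a b → T (a == b) → T (b == a)
    flip a b t with refl ← ==⇒≡ {a = a} {b} t = ≡true⇒T (==-refl a)

  ≢⇒==false : ∀ {n} {a x : Fin n} → a ≢ x → (a == x) ≡ false
  ≢⇒==false ne = ¬T⇒≡false (ne ∘ ==⇒≡)

  remove : ∀ {n} → Sub n → Fin n → Sub n
  remove A a x = A x ∧ not (a == x)

  _⊆_ : ∀ {n} → Sub n → Sub n → Set
  S ⊆ W = ∀ x → T (S x) → T (W x)

  size-cong : ∀ {n} {A B : Sub n} → (∀ x → A x ≡ B x) → size A ≡ size B
  size-cong e = sum-cong-≗ (cong ind ∘ e)

  size-split : ∀ {n} (A B : Sub n) → size A ≡ size (λ x → A x ∧ B x) + size (λ x → A x ∧ not (B x))
  size-split A B = trans (sum-cong-≗ (λ x → ind-split (A x) (B x))) (∑-distrib-+ (ind ∘ (λ x → A x ∧ B x)) (ind ∘ (λ x → A x ∧ not (B x))))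
    where
    ind-split : ∀ a b → ind a ≡ ind (a ∧ b) + ind (a ∧ not b)
    ind-split false b = refl
    ind-split true false = refl
    ind-split true true = refl

  size-remove : ∀ {n} (A : Sub n) a → T (A a) → size A ≡ suc (size (remove A a))
  size-remove {n} A a t = trans (size-split A (a ==_)) (cong (_+ size (remove A a)) singleton)
    where
    singleton : size (λ x → A x ∧ (a == x)) ≡ 1
    singleton = begin
      size (λ x → A x ∧ (a == x))
        ≡⟨ sum-single-out _ (λ _ → 0) a off-a refl ⟩
      sum {n} (λ _ → 0) + ind (A a ∧ (a == a))
        ≡⟨ cong₂ (λ s z → s + ind (z ∧ (a == a))) (sum-zero {n} (λ _ → 0) (λ _ → refl)) (T⇒≡true t) ⟩
      ind (a == a)
        ≡⟨ cong ind (==-refl a) ⟩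
      1 ∎
      where
      off-a : ∀ u → u ≢ a → ind (A u ∧ (a == u)) ≡ 0
      off-a u ne rewrite ≢⇒==false (ne ∘ sym) = cong ind (∧-zeroʳ (A u))

  size-≤ : ∀ {n} (A : Sub n) → size A ≤ n
  size-≤ {zero} A = z≤n
  size-≤ {suc n} A = +-mono-≤ (ind≤1 (A zero)) (size-≤ (A ∘ suc))

  size-full : ∀ n → size {n} (λ _ → true) ≡ n
  size-full zero = refl
  size-full (suc n) = cong suc (size-full n)

  size-∅ : ∀ n → size {n} (λ _ → false) ≡ 0
  size-∅ zero = refl
  size-∅ (suc n) = size-∅ n

  size-pos : ∀ {n} (A : Sub n) → 0 < size A → Σ (Fin n) (T ∘ A)
  size-pos {suc n} A lt with A zero in eq
  ... | true = zero , ≡true⇒T eq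
  ... | false with x , t ← size-pos (A ∘ suc) lt = suc x , t

  size-0 : ∀ {n} (A : Sub n) → size A ≡ 0 → ∀ x → A x ≡ false
  size-0 A e x = ¬T⇒≡false λ t → 1+n≢0 (trans (sym (size-remove A x t)) e)

  size-∩-subset : ∀ {n} (S W : Sub n) → S ⊆ W → size (λ x → W x ∧ S x) ≡ size S
  size-∩-subset S W sub = size-cong ∩-subset
    where
    ∩-subset : ∀ x → (W x ∧ S x) ≡ S x
    ∩-subset x with S x in eq
    ... | false = ∧-zeroʳ (W x)
    ... | true rewrite T⇒≡true (sub x (≡true⇒T eq)) = refl

  size-∖-subset : ∀ {n} (S W : Sub n) → S ⊆ W → size (λ x → W x ∧ not (S x)) ≡ size W ∸ size S
  size-∖-subset S W sub = sym (begin
    size W ∸ size S                                                        ≡⟨ cong (_∸ size S) (size-split W S) ⟩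
    size (λ x → W x ∧ S x) + size (λ x → W x ∧ not (S x)) ∸ size S         ≡⟨ cong (λ z → z + size (λ x → W x ∧ not (S x)) ∸ size S) (size-∩-subset S W sub) ⟩
    size S + size (λ x → W x ∧ not (S x)) ∸ size S                         ≡⟨ m+n∸m≡n (size S) _ ⟩
    size (λ x → W x ∧ not (S x))                                           ∎)

  size-mono : ∀ {n} (S W : Sub n) → S ⊆ W → size S ≤ size W
  size-mono S W sub = subst (_≤ size W) (size-∩-subset S W sub) (subst (size (λ x → W x ∧ S x) ≤_) (sym (size-split W S)) (m≤m+n _ _))

  every : ∀ {n} → (Fin n → Bool) → Bool
  every {zero} f = true
  every {suc n} f = f zero ∧ every (f ∘ suc)

  every-cong : ∀ {n} {f g : Fin n → Bool} → (∀ x → f x ≡ g x) → every f ≡ every g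
  every-cong {zero} e = refl
  every-cong {suc n} e = cong₂ _∧_ (e zero) (every-cong (e ∘ suc))

  every-elim : ∀ {n} (f : Fin n → Bool) → T (every f) → ∀ x → T (f x)
  every-elim {suc n} f t zero = T-∧-fst (f zero) t
  every-elim {suc n} f t (suc x) = every-elim (f ∘ suc) (T-∧-snd (f zero) t) x

  every-intro : ∀ {n} (f : Fin n → Bool) → (∀ x → T (f x)) → T (every f)
  every-intro {zero} f h = tt
  every-intro {suc n} f h = T-∧-intro (h zero) (every-intro (f ∘ suc) (h ∘ suc))

  minimum : ∀ {n} (W : Sub n) x → T (W x) → Σ (Fin n) (λ w₀ → T (W w₀) × (∀ u → toℕ u < toℕ w₀ → W u ≡ false))
  minimum {suc n} W x t with W zero in eq
  ... | true = zero , ≡true⇒T eq , (λ u ())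
  minimum {suc n} W zero t | false = ⊥-elim (subst T eq t)
  minimum {suc n} W (suc x) t | false with w₀ , tw , least ← minimum (W ∘ suc) x t = suc w₀ , tw , least′
    where
    least′ : ∀ u → toℕ u < toℕ (Fin.suc w₀) → W u ≡ false
    least′ zero _ = eq
    least′ (suc u) (s≤s lt) = least u lt

module CanonicalMatchings where

  open Counting
  open import Data.Bool using (Bool; true; false; _∧_; _∨_; _xor_; not; T)
  open import Data.Bool.Properties using (∧-idempotentCommutativeMonoid; ∨-∧-booleanAlgebra; ∧-identityʳ; ∨-zeroʳ)
  open import Algebra.Lattice.Properties.BooleanAlgebra ∨-∧-booleanAlgebra using (deMorgan₂)
  open import Data.Bool.ListAction using (any)
  open import Data.Nat using (ℕ; suc; _*_; _<ᵇ_; _≡ᵇ_)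
  open import Data.Nat.Properties using (+-*-semiring; <ᵇ⇒<; <⇒<ᵇ; <-trans; <-irrefl; ≡ᵇ⇒≡)
  open import Data.Fin using (Fin; toℕ)
  open import Data.Product using (_,_; proj₁; proj₂)
  open import Algebra.Properties.Semiring.Sum +-*-semiring using (sum)
  open import Data.Vec using (Vec; []; _∷_)
  import Data.List as List
  open import Data.Unit using (tt)
  open import Function using (_∘_)
  open import Relation.Binary.PropositionalEquality
  open import Algebra.Solver.IdempotentCommutativeMonoid ∧-idempotentCommutativeMonoid using (solve; _⊕_; _⊜_)
  open ≡-Reasoning

  allIn : ∀ {n m} → Sub n → Vec (Edge n) m → Bool
  allIn W [] = true
  allIn W ((u , v) ∷ es) = W u ∧ (W v ∧ allIn W es)

  allIn-∧ : ∀ {n m} (A B : Sub n) (es : Vec (Edge n) m) →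
    allIn (λ x → A x ∧ B x) es ≡ allIn A es ∧ allIn B es
  allIn-∧ A B [] = refl
  allIn-∧ A B ((u , v) ∷ es) rewrite allIn-∧ A B es =
    solve 6 (λ a b c d e f → (a ⊕ b) ⊕ ((c ⊕ d) ⊕ (e ⊕ f)) ⊜ (a ⊕ (c ⊕ e)) ⊕ (b ⊕ (d ⊕ f)))
      refl (A u) (B u) (A v) (B v) (allIn A es) (allIn B es)

  allIn-everywhere : ∀ {n m} (es : Vec (Edge n) m) → T (allIn (λ _ → true) es)
  allIn-everywhere [] = tt
  allIn-everywhere ((u , v) ∷ es) = allIn-everywhere es

  allIn-mono : ∀ {n m} {A B : Sub n} (es : Vec (Edge n) m) → A ⊆ B → T (allIn A es) → T (allIn B es)
  allIn-mono [] h t = tt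
  allIn-mono {A = A} ((u , v) ∷ es) h t =
    T-∧-intro (h u (T-∧-fst (A u) t)) (T-∧-intro (h v (T-∧-fst (A v) t′)) (allIn-mono es h (T-∧-snd (A v) t′)))
    where
    t′ : T (A v ∧ allIn A es)
    t′ = T-∧-snd (A u) t

  startsAbove : ∀ {n m} → Fin n → Vec (Edge n) m → Bool
  startsAbove u [] = true
  startsAbove u ((a , b) ∷ _) = toℕ u <ᵇ toℕ a

  sortedOK-cons : ∀ {n m} (u v : Fin n) (es : Vec (Edge n) m) → sortedOK ((u , v) ∷ es) ≡ startsAbove u es ∧ sortedOK es
  sortedOK-cons u v [] = refl
  sortedOK-cons u v (f ∷ es) = refl

  <ᵇ-trans : ∀ a b c → T (a <ᵇ b) → T (b <ᵇ c) → T (a <ᵇ c)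
  <ᵇ-trans a b c s t = <⇒<ᵇ (<-trans (<ᵇ⇒< a b s) (<ᵇ⇒< b c t))

  <ᵇ⇒≢ᵇ : ∀ a b → T (a <ᵇ b) → T (not (a ≡ᵇ b))
  <ᵇ⇒≢ᵇ a b t with a ≡ᵇ b in eq
  ... | false = tt
  ... | true = <-irrefl (≡ᵇ⇒≡ a b (≡true⇒T eq)) (<ᵇ⇒< a b t)

  startsAbove⇔allAbove : ∀ {n m} (u : Fin n) (es : Vec (Edge n) m) → T (orientedOK es ∧ sortedOK es) →
    startsAbove u es ≡ allIn (λ x → toℕ u <ᵇ toℕ x) es
  startsAbove⇔allAbove u es ok = T-ext (allAbove es ok) (startsAbove-of es)
    where
    allAbove : ∀ {m} (es : Vec (Edge _) m) → T (orientedOK es ∧ sortedOK es) → T (startsAbove u es) → T (allIn (λ x → toℕ u <ᵇ toℕ x) es)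
    allAbove [] _ _ = tt
    allAbove ((a , b) ∷ es) ok u<a with toℕ a <ᵇ toℕ b in a<b | orientedOK es in oriented
    ... | true | true rewrite sortedOK-cons a b es =
      T-∧-intro u<a (T-∧-intro (<ᵇ-trans (toℕ u) (toℕ a) (toℕ b) u<a (≡true⇒T a<b))
                    (allAbove es (T-∧-intro (≡true⇒T oriented) (T-∧-snd (startsAbove a es) ok)) (u<next es (T-∧-fst (startsAbove a es) ok))))
      where
      u<next : ∀ {m} (es : Vec (Edge _) m) → T (startsAbove a es) → T (startsAbove u es)
      u<next [] _ = tt
      u<next ((c , d) ∷ _) a<c = <ᵇ-trans (toℕ u) (toℕ a) (toℕ c) u<a a<c
    startsAbove-of : ∀ {m} (es : Vec (Edge _) m) → T (allIn (λ x → toℕ u <ᵇ toℕ x) es) → T (startsAbove u es)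
    startsAbove-of [] _ = tt
    startsAbove-of ((a , b) ∷ es) t = T-∧-fst (toℕ u <ᵇ toℕ a) t

  covered : ∀ {n m} → Fin n → Vec (Edge n) m → Bool
  covered s es = any (toℕ s ≡ᵇ_) (endpoints es)

  covered-first : ∀ {n m} (u v : Fin n) (es : Vec (Edge n) m) → T (covered u ((u , v) ∷ es))
  covered-first u v es rewrite ==-refl u = tt

  covered-second : ∀ {n m} (u v : Fin n) (es : Vec (Edge n) m) → T (covered v ((u , v) ∷ es))
  covered-second u v es rewrite ==-refl v = subst T (sym (∨-zeroʳ (v == u))) tt

  covered-later : ∀ {n m} (s : Fin n) (e : Edge n) (es : Vec (Edge n) m) → T (covered s es) → T (covered s (e ∷ es))
  covered-later s (u , v) es cov rewrite T⇒≡true cov = subst T (sym (trans (cong ((s == u) ∨_) (∨-zeroʳ (s == v))) (∨-zeroʳ (s == u)))) tt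

  uncovered⇔avoided : ∀ {n m} (a : Fin n) (es : Vec (Edge n) m) →
    not (covered a es) ≡ allIn (λ x → not (a == x)) es
  uncovered⇔avoided a [] = refl
  uncovered⇔avoided a ((u , v) ∷ es) rewrite deMorgan₂ (a == u) (any (toℕ a ≡ᵇ_) (toℕ v List.∷ endpoints es))
                                           | deMorgan₂ (a == v) (covered a es)
                                           | uncovered⇔avoided a es = refl

  -- The vertices still available for the later edges of a canonical matching with
  -- first edge (u, v): those above u, other than v.
  beyond : ∀ {n} → Fin n → Fin n → Sub n
  beyond u v x = (toℕ u <ᵇ toℕ x) ∧ not (v == x)

  isMatching-cons : ∀ {n m} (u v : Fin n) (es : Vec (Edge n) m) →
    isMatching ((u , v) ∷ es) ≡ (toℕ u <ᵇ toℕ v) ∧ (allIn (beyond u v) es ∧ isMatching es)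
  isMatching-cons u v es = begin
    (not ((u == v) ∨ any (toℕ u ≡ᵇ_) L) ∧ (not (any (toℕ v ≡ᵇ_) L) ∧ D)) ∧ ((P ∧ O) ∧ sortedOK ((u , v) ∷ es))
      ≡⟨ cong₂ (λ x y → x ∧ ((P ∧ O) ∧ y)) distinct-cons (sortedOK-cons u v es) ⟩
    ((not (u == v) ∧ U) ∧ (V ∧ D)) ∧ ((P ∧ O) ∧ (startsAbove u es ∧ So))
      ≡⟨ solve 8 (λ e U V D P O H So → ((e ⊕ U) ⊕ (V ⊕ D)) ⊕ ((P ⊕ O) ⊕ (H ⊕ So))
                                       ⊜ (P ⊕ e) ⊕ (((O ⊕ So) ⊕ H) ⊕ (U ⊕ (V ⊕ D))))
           refl (not (u == v)) U V D P O (startsAbove u es) So ⟩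
    (P ∧ not (u == v)) ∧ (((O ∧ So) ∧ startsAbove u es) ∧ (U ∧ (V ∧ D)))
      ≡⟨ cong₂ (λ x y → x ∧ (y ∧ (U ∧ (V ∧ D))))
           (∧-implied P (not (u == v)) (<ᵇ⇒≢ᵇ (toℕ u) (toℕ v)))
           (∧-cong-under (O ∧ So) (startsAbove⇔allAbove u es)) ⟩
    P ∧ (((O ∧ So) ∧ G) ∧ (U ∧ (V ∧ D)))
      ≡⟨ solve 7 (λ P O So G U V D → P ⊕ (((O ⊕ So) ⊕ G) ⊕ (U ⊕ (V ⊕ D)))
                                    ⊜ P ⊕ (((G ⊕ U) ⊕ V) ⊕ (D ⊕ (O ⊕ So))))
           refl P O So G U V D ⟩
    P ∧ (((G ∧ U) ∧ V) ∧ isMatching es)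
      ≡⟨ cong (λ x → P ∧ ((x ∧ V) ∧ isMatching es))
           (∧-implied G U (allIn-mono es (λ x → <ᵇ⇒≢ᵇ (toℕ u) (toℕ x)))) ⟩
    P ∧ ((G ∧ V) ∧ isMatching es)
      ≡⟨ cong (λ x → P ∧ (x ∧ isMatching es)) (allIn-∧ _ _ es) ⟨
    P ∧ (allIn (beyond u v) es ∧ isMatching es) ∎
    where
    L : List.List ℕ
    L = endpoints es
    D O So P G U V : Bool
    D = allDistinct L
    O = orientedOK es
    So = sortedOK es
    P = toℕ u <ᵇ toℕ v
    G = allIn (λ x → toℕ u <ᵇ toℕ x) es
    U = allIn (λ x → not (u == x)) es
    V = allIn (λ x → not (v == x)) es
    distinct-cons : allDistinct (toℕ u List.∷ toℕ v List.∷ L) ≡ (not (u == v) ∧ U) ∧ (V ∧ D)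
    distinct-cons rewrite deMorgan₂ (u == v) (any (toℕ u ≡ᵇ_) L) | uncovered⇔avoided u es | uncovered⇔avoided v es = refl

  agree : Bool → Bool → Bool
  agree a b = not (a xor b)

  agree-refl : ∀ b → T (agree b b)
  agree-refl false = tt
  agree-refl true = tt

  respects : ∀ {n m} → Sub n → Vec (Edge n) m → Bool
  respects S [] = true
  respects S ((u , v) ∷ es) = agree (S u) (S v) ∧ respects S es

  respects-∅ : ∀ {n m} (es : Vec (Edge n) m) → respects (λ _ → false) es ≡ true
  respects-∅ [] = refl
  respects-∅ ((u , v) ∷ es) = respects-∅ es

  respects-cong : ∀ {n m} {A S S′ : Sub n} (es : Vec (Edge n) m) →
    (∀ x → T (A x) → S x ≡ S′ x) → T (allIn A es) → respects S es ≡ respects S′ es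
  respects-cong [] h t = refl
  respects-cong {A = A} ((u , v) ∷ es) h t =
    cong₂ _∧_ (cong₂ agree (h u (T-∧-fst (A u) t)) (h v (T-∧-fst (A v) (T-∧-snd (A u) t))))
              (respects-cong es h (T-∧-snd (A v) (T-∧-snd (A u) t)))

  covers : ∀ {n m} → Sub n → Vec (Edge n) m → Bool
  covers S es = every (λ s → not (S s) ∨ covered s es)

  without : ∀ {n} → Sub n → Fin n → Fin n → Sub n
  without S u v x = S x ∧ (not (u == x) ∧ not (v == x))

  covers-cons : ∀ {n m} (S : Sub n) (u v : Fin n) (es : Vec (Edge n) m) →
    covers S ((u , v) ∷ es) ≡ covers (without S u v) es
  covers-cons S u v es = every-cong pointwise
    where
    pointwise : ∀ s → (not (S s) ∨ covered s ((u , v) ∷ es)) ≡ (not (without S u v s) ∨ covered s es)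
    pointwise s rewrite ==-sym s u | ==-sym s v with S s | u == s | v == s
    ... | false | _ | _ = refl
    ... | true | true | _ = refl
    ... | true | false | true = refl
    ... | true | false | false = refl

  Compatible : ∀ {n m} → Sub n → Sub n → Vec (Edge n) m → Bool
  Compatible W S es = isMatching es ∧ (allIn W es ∧ (respects S es ∧ covers S es))

  allEdges : (n : ℕ) → List.List (Edge n)
  allEdges n = List.cartesianProduct (List.allFin n) (List.allFin n)

  ncompat : ∀ {n} → Sub n → Sub n → ℕ → ℕ
  ncompat {n} W S m = count (Compatible W S) (allVecs (allEdges n) m)

  after : ∀ {n} → Sub n → Fin n → Fin n → Sub n
  after W u v x = W x ∧ beyond u v x

  firstEdgeOK : ∀ {n} → Sub n → Sub n → Fin n → Fin n → Bool
  firstEdgeOK W S u v = (toℕ u <ᵇ toℕ v) ∧ (W u ∧ (W v ∧ agree (S u) (S v)))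

  Compatible-cons : ∀ {n m} (W S : Sub n) (u v : Fin n) (es : Vec (Edge n) m) →
    Compatible W S ((u , v) ∷ es) ≡ firstEdgeOK W S u v ∧ Compatible (after W u v) (without S u v) es
  Compatible-cons W S u v es = begin
    isMatching ((u , v) ∷ es) ∧ ((W u ∧ (W v ∧ IW)) ∧ ((ag ∧ R) ∧ covers S ((u , v) ∷ es)))
      ≡⟨ cong₂ (λ x y → x ∧ ((W u ∧ (W v ∧ IW)) ∧ ((ag ∧ R) ∧ y))) (isMatching-cons u v es) (covers-cons S u v es) ⟩
    (P ∧ (B ∧ M)) ∧ ((W u ∧ (W v ∧ IW)) ∧ ((ag ∧ R) ∧ C))
      ≡⟨ solve 9 (λ P B M Wu Wv IW ag R C → (P ⊕ (B ⊕ M)) ⊕ ((Wu ⊕ (Wv ⊕ IW)) ⊕ ((ag ⊕ R) ⊕ C))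
                                           ⊜ (B ⊕ R) ⊕ ((P ⊕ (Wu ⊕ (Wv ⊕ ag))) ⊕ (M ⊕ (IW ⊕ C))))
           refl P B M (W u) (W v) IW ag R C ⟩
    (B ∧ R) ∧ rest
      ≡⟨ cong (_∧ rest) (∧-cong-under B (respects-cong es off-edge)) ⟩
    (B ∧ R′) ∧ rest
      ≡⟨ solve 9 (λ P B M Wu Wv IW ag R′ C → (B ⊕ R′) ⊕ ((P ⊕ (Wu ⊕ (Wv ⊕ ag))) ⊕ (M ⊕ (IW ⊕ C)))
                                            ⊜ (P ⊕ (Wu ⊕ (Wv ⊕ ag))) ⊕ (M ⊕ ((IW ⊕ B) ⊕ (R′ ⊕ C))))
           refl P B M (W u) (W v) IW ag R′ C ⟩
    firstEdgeOK W S u v ∧ (M ∧ ((IW ∧ B) ∧ (R′ ∧ C)))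
      ≡⟨ cong (λ x → firstEdgeOK W S u v ∧ (M ∧ (x ∧ (R′ ∧ C)))) (allIn-∧ W (beyond u v) es) ⟨
    firstEdgeOK W S u v ∧ Compatible (after W u v) (without S u v) es ∎
    where
    P B M IW ag R R′ C rest : Bool
    P = toℕ u <ᵇ toℕ v
    B = allIn (beyond u v) es
    M = isMatching es
    IW = allIn W es
    ag = agree (S u) (S v)
    R = respects S es
    R′ = respects (without S u v) es
    C = covers (without S u v) es
    rest = (P ∧ (W u ∧ (W v ∧ ag))) ∧ (M ∧ (IW ∧ C))
    off-edge : ∀ x → T (beyond u v x) → S x ≡ without S u v x
    off-edge x t rewrite T⇒≡true (<ᵇ⇒≢ᵇ (toℕ u) (toℕ x) (T-∧-fst (toℕ u <ᵇ toℕ x) t))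
                       | T⇒≡true (T-∧-snd (toℕ u <ᵇ toℕ x) t) = sym (∧-identityʳ (S x))

  byFirstEdge : ∀ {n} → Sub n → Sub n → ℕ → Fin n → Fin n → ℕ
  byFirstEdge W S m u v = ind (firstEdgeOK W S u v) * ncompat (after W u v) (without S u v) m

  ncompat-suc : ∀ {n} (W S : Sub n) m → ncompat W S (suc m) ≡ sum (λ u → sum (λ v → byFirstEdge W S m u v))
  ncompat-suc {n} W S m = begin
    count (Compatible W S) (List.concatMap (λ e → List.map (e ∷_) AV) (allEdges n))
      ≡⟨ sumL-concatMap (ind ∘ Compatible W S) (λ e → List.map (e ∷_) AV) (allEdges n) ⟩
    sumL (λ e → count (Compatible W S) (List.map (e ∷_) AV)) (allEdges n)
      ≡⟨ sumL-cong (allEdges n) (λ e → sumL-map (ind ∘ Compatible W S) (e ∷_) AV) ⟩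
    sumL (λ e → count (λ es → Compatible W S (e ∷ es)) AV) (allEdges n)
      ≡⟨ sumL-cong (allEdges n) (λ { (u , v) → trans (sumL-cong AV (cong ind ∘ Compatible-cons W S u v))
                                                      (count-guard (firstEdgeOK W S u v) _ AV) }) ⟩
    sumL (λ e → byFirstEdge W S m (proj₁ e) (proj₂ e)) (allEdges n)
      ≡⟨ sumL-cartesian (λ e → byFirstEdge W S m (proj₁ e) (proj₂ e)) (List.allFin n) (List.allFin n) ⟩
    sumL (λ u → sumL (byFirstEdge W S m u) (List.allFin n)) (List.allFin n)
      ≡⟨ sumL-cong (List.allFin n) (λ u → sumL-allFin (byFirstEdge W S m u)) ⟩
    sumL (λ u → sum (byFirstEdge W S m u)) (List.allFin n)
      ≡⟨ sumL-allFin (λ u → sum (byFirstEdge W S m u)) ⟩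
    sum (λ u → sum (byFirstEdge W S m u)) ∎
    where
    AV : List.List (Vec (Edge n) m)
    AV = allVecs (allEdges n) m

module CompatibleMatchings where

  open MatchingNumbers
  open Counting
  open CanonicalMatchings
  open import Data.Bool using (true; false; _∧_; _∨_; not; T)
  open import Data.Bool.Properties using (∧-zeroʳ; ∧-identityʳ; ∧-assoc)
  open import Data.Nat
  open import Data.Nat.Properties
  open import Data.Fin using (Fin; toℕ)
  open import Data.Fin.Properties using (toℕ-injective)
  open import Data.Product using (_,_)
  open import Data.Sum using (inj₁; inj₂)
  open import Data.Vec using (Vec; _∷_)
  open import Data.Empty using (⊥-elim)
  open import Data.Unit using (tt)
  open import Function using (_∘_)
  open import Relation.Nullary using (yes; no)
  open import Relation.Binary.PropositionalEquality
  open import Algebra.Properties.Semiring.Sum +-*-semiring using (sum; sum-cong-≗; *-distribʳ-sum)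
  open ≡-Reasoning

  ncompat-cong : ∀ {n} {W W′ S S′ : Sub n} m → (∀ x → W x ≡ W′ x) → (∀ x → S x ≡ S′ x) →
    ncompat W S m ≡ ncompat W′ S′ m
  ncompat-cong {n} {W} {W′} {S} {S′} m eW eS = sumL-cong (allVecs (allEdges n) m) (cong ind ∘ compatible-cong)
    where
    compatible-cong : ∀ es → Compatible W S es ≡ Compatible W′ S′ es
    compatible-cong es = cong (isMatching es ∧_) (cong₂ _∧_
      (T-ext (allIn-mono es (λ x → subst T (eW x))) (allIn-mono es (λ x → subst T (sym (eW x)))))
      (cong₂ _∧_ (respects-cong es (λ x _ → eS x) (allIn-everywhere es))
                 (every-cong (λ s → cong (λ z → not z ∨ covered s es) (eS s)))))

  covered-allIn : ∀ {n m} (W : Sub n) (s : Fin n) (es : Vec (Edge n) m) → T (allIn W es) → T (covered s es) → T (W s)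
  covered-allIn W s ((u , v) ∷ es) inW cov with T-∨-elim (s == u) cov
  ... | inj₁ s≡u rewrite ==⇒≡ {a = s} {u} s≡u = T-∧-fst (W u) inW
  ... | inj₂ cov′ with T-∨-elim (s == v) cov′
  ...   | inj₁ s≡v rewrite ==⇒≡ {a = s} {v} s≡v = T-∧-fst (W v) (T-∧-snd (W u) inW)
  ...   | inj₂ cov″ = covered-allIn W s es (T-∧-snd (W v) (T-∧-snd (W u) inW)) cov″

  covers-elim : ∀ {n m} (S : Sub n) (s : Fin n) (es : Vec (Edge n) m) → T (covers S es) → T (S s) → T (covered s es)
  covers-elim S s es all inS with every-elim (λ s → not (S s) ∨ covered s es) all s
  ... | t rewrite T⇒≡true inS = t

  ncompat-⊈ : ∀ {n} (W S : Sub n) (s : Fin n) m → T (S s) → W s ≡ false → ncompat W S m ≡ 0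
  ncompat-⊈ {n} W S s m inS outW = count-none (Compatible W S) (allVecs (allEdges n) m) λ es →
    ¬T⇒≡false λ t → ≡false⇒¬T outW
      (covered-allIn W s es (T-∧-fst (allIn W es) (T-∧-snd (isMatching es) t))
        (covers-elim S s es (T-∧-snd (respects S es) (T-∧-snd (allIn W es) (T-∧-snd (isMatching es) t))) inS))

  ncompat-0-empty : ∀ {n} (W S : Sub n) → size S ≡ 0 → ncompat W S 0 ≡ 1
  ncompat-0-empty W S e = cong (λ z → ind z + 0) (T⇒≡true (every-intro _ λ s → subst (λ z → T (not z ∨ false)) (sym (size-0 S e s)) tt))

  ncompat-0-nonempty : ∀ {n} (W S : Sub n) k → size S ≡ suc k → ncompat W S 0 ≡ 0
  ncompat-0-nonempty W S k e with s , inS ← size-pos S (subst (0 <_) (sym e) z<s) =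
    cong (λ z → ind z + 0) (¬T⇒≡false λ t → subst (λ z → T (not z ∨ false)) (T⇒≡true inS) (every-elim _ t s))

  byFirstEdge-inadmissible : ∀ {n} (W S : Sub n) m u v → firstEdgeOK W S u v ≡ false → byFirstEdge W S m u v ≡ 0
  byFirstEdge-inadmissible W S m u v e rewrite e = refl

  ncompat-emptyW : ∀ {n} (W S : Sub n) m → (∀ x → W x ≡ false) → ncompat W S (suc m) ≡ 0
  ncompat-emptyW W S m e = trans (ncompat-suc W S m) (sum-zero _ λ u → sum-zero _ λ v →
    byFirstEdge-inadmissible W S m u v (no-first-edge u v))
    where
    no-first-edge : ∀ u v → firstEdgeOK W S u v ≡ false
    no-first-edge u v rewrite e u = ∧-zeroʳ _

  -- The closed form  ncompat W S m = compat |W| (|S|/2) m  for S ⊆ W, stated for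
  -- all W below a size bound so that it can be proved by induction on the bound.
  ClosedForm : ℕ → Set
  ClosedForm bound = ∀ {n} w (W S : Sub n) j m → w ≤ bound → size W ≡ w → size S ≡ 2 * j → S ⊆ W →
    ncompat W S m ≡ compat w j m

  -- Removing the least vertex w₀ of W: the compatible matchings in W either avoid
  -- w₀ (they are the compatible matchings in W′ = W - w₀) or have w₀ as the first
  -- endpoint of their first edge.
  module LeastVertex {n : ℕ} (W S : Sub n) (w₀ : Fin n) (w₀∈W : T (W w₀))
                     (least : ∀ u → toℕ u < toℕ w₀ → W u ≡ false) where

    W′ : Sub n
    W′ = remove W w₀

    above-w₀ : ∀ v → T (W v) → (toℕ w₀ <ᵇ toℕ v) ≡ not (w₀ == v)
    above-w₀ v v∈W with toℕ w₀ <ᵇ toℕ v in lt | w₀ == v in eq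
    ... | true | true = ⊥-elim (<-irrefl (cong toℕ (==⇒≡ {a = w₀} {v} (≡true⇒T eq))) (<ᵇ⇒< (toℕ w₀) (toℕ v) (≡true⇒T lt)))
    ... | true | false = refl
    ... | false | true = refl
    ... | false | false = ⊥-elim (≡false⇒¬T (least v v<w₀) v∈W)
      where
      v<w₀ : toℕ v < toℕ w₀
      v<w₀ = ≤∧≢⇒< (≮⇒≥ (≡false⇒¬T lt ∘ <⇒<ᵇ)) (≡false⇒¬T eq ∘ ≡⇒≡ᵇ (toℕ w₀) (toℕ v) ∘ sym)

    w₀∉W′ : W′ w₀ ≡ false
    w₀∉W′ rewrite ==-refl w₀ = ∧-zeroʳ (W w₀)

    W′-above : ∀ x → toℕ w₀ < toℕ x → W x ≡ W′ x
    W′-above x lt rewrite ≢⇒==false {a = w₀} {x} (λ q → <-irrefl (cong toℕ q) lt) = sym (∧-identityʳ (W x))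

    byFirstEdge-≢w₀ : ∀ m u → u ≢ w₀ → ∀ v → byFirstEdge W S m u v ≡ byFirstEdge W′ S m u v
    byFirstEdge-≢w₀ m u u≢w₀ v with toℕ u <? toℕ w₀
    ... | yes u<w₀ = trans (byFirstEdge-inadmissible W S m u v (no-edge W (least u u<w₀)))
                           (sym (byFirstEdge-inadmissible W′ S m u v (no-edge W′ u∉W′)))
      where
      u∉W′ : W′ u ≡ false
      u∉W′ rewrite least u u<w₀ = refl
      no-edge : ∀ A → A u ≡ false → firstEdgeOK A S u v ≡ false
      no-edge A e rewrite e = ∧-zeroʳ _
    ... | no u≮w₀ = cong₂ (λ b k → ind b * k) same-edge (ncompat-cong m same-after (λ _ → refl))
      where
      w₀<u : toℕ w₀ < toℕ u
      w₀<u = ≤∧≢⇒< (≮⇒≥ u≮w₀) (λ e → u≢w₀ (sym (toℕ-injective e)))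
      same-edge : firstEdgeOK W S u v ≡ firstEdgeOK W′ S u v
      same-edge with toℕ u <ᵇ toℕ v in u<v
      ... | false = refl
      ... | true = cong₂ (λ a b → a ∧ (b ∧ agree (S u) (S v)))
                         (W′-above u w₀<u) (W′-above v (<-trans w₀<u (<ᵇ⇒< _ _ (≡true⇒T u<v))))
      same-after : ∀ x → after W u v x ≡ after W′ u v x
      same-after x with toℕ u <ᵇ toℕ x in u<x
      ... | false = trans (∧-zeroʳ (W x)) (sym (∧-zeroʳ _))
      ... | true = cong (_∧ not (v == x)) (W′-above x (<-trans w₀<u (<ᵇ⇒< _ _ (≡true⇒T u<x))))

    byFirstEdge-w₀ : ∀ m v → byFirstEdge W′ S m w₀ v ≡ 0
    byFirstEdge-w₀ m v = byFirstEdge-inadmissible W′ S m w₀ v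
      (trans (cong (λ z → (toℕ w₀ <ᵇ toℕ v) ∧ (z ∧ (W′ v ∧ agree (S w₀) (S v)))) w₀∉W′) (∧-zeroʳ _))

    ncompat-split : ∀ m → ncompat W S (suc m) ≡ ncompat W′ S (suc m) + sum (byFirstEdge W S m w₀)
    ncompat-split m = begin
      ncompat W S (suc m)
        ≡⟨ ncompat-suc W S m ⟩
      sum (λ u → sum (byFirstEdge W S m u))
        ≡⟨ sum-single-out _ (λ u → sum (byFirstEdge W′ S m u)) w₀ (λ u u≢w₀ → sum-cong-≗ (byFirstEdge-≢w₀ m u u≢w₀))
                          (sum-zero _ (byFirstEdge-w₀ m)) ⟩
      sum (λ u → sum (byFirstEdge W′ S m u)) + sum (byFirstEdge W S m w₀)
        ≡⟨ cong (_+ sum (byFirstEdge W S m w₀)) (ncompat-suc W′ S m) ⟨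
      ncompat W′ S (suc m) + sum (byFirstEdge W S m w₀) ∎

    sum-byFirstEdge-w₀ : ∀ m c → (∀ v → T (firstEdgeOK W S w₀ v) → ncompat (after W w₀ v) (without S w₀ v) m ≡ c) →
      sum (byFirstEdge W S m w₀) ≡ size (firstEdgeOK W S w₀) * c
    sum-byFirstEdge-w₀ m c h = trans (sum-cong-≗ constant) (sym (*-distribʳ-sum c (ind ∘ firstEdgeOK W S w₀)))
      where
      constant : ∀ v → byFirstEdge W S m w₀ v ≡ ind (firstEdgeOK W S w₀ v) * c
      constant v with firstEdgeOK W S w₀ v in ok
      ... | true = cong (1 *_) (h v (≡true⇒T ok))
      ... | false = refl

    size-W′ : ∀ w′ → size W ≡ suc w′ → size W′ ≡ w′
    size-W′ w′ e = suc-injective (trans (sym (size-remove W w₀ w₀∈W)) e)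

    size-after : ∀ w′ v → size W ≡ suc w′ → T (W v) → v ≢ w₀ → size (after W w₀ v) ≡ w′ ∸ 1
    size-after w′ v e v∈W v≢w₀ = begin
      size (after W w₀ v)    ≡⟨ size-cong after≡W′-v ⟩
      size (remove W′ v)     ≡⟨ cong (_∸ 1) (size-remove W′ v v∈W′) ⟨
      size W′ ∸ 1            ≡⟨ cong (_∸ 1) (size-W′ w′ e) ⟩
      w′ ∸ 1                 ∎
      where
      after≡W′-v : ∀ x → after W w₀ v x ≡ remove W′ v x
      after≡W′-v x with W x in x∈W
      ... | false = refl
      ... | true rewrite above-w₀ x (≡true⇒T x∈W) = refl
      v∈W′ : T (W′ v)
      v∈W′ rewrite ≢⇒==false (v≢w₀ ∘ sym) = subst T (sym (∧-identityʳ (W v))) v∈W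

    without⊆after : S ⊆ W → ∀ v → without S w₀ v ⊆ after W w₀ v
    without⊆after S⊆W v x t = T-∧-intro x∈W (T-∧-intro w₀<x (T-∧-snd (not (w₀ == x)) (T-∧-snd (S x) t)))
      where
      x∈W : T (W x)
      x∈W = S⊆W x (T-∧-fst (S x) t)
      w₀<x : T (toℕ w₀ <ᵇ toℕ x)
      w₀<x = subst T (sym (above-w₀ x x∈W)) (T-∧-fst (not (w₀ == x)) (T-∧-snd (S x) t))

    partners-in-S : S w₀ ≡ true → S ⊆ W → ∀ v → firstEdgeOK W S w₀ v ≡ remove S w₀ v
    partners-in-S w₀∈S S⊆W v rewrite T⇒≡true w₀∈W | w₀∈S with S v in v∈S
    ... | false = trans (cong ((toℕ w₀ <ᵇ toℕ v) ∧_) (∧-zeroʳ (W v))) (∧-zeroʳ _)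
    ... | true rewrite T⇒≡true (S⊆W v (≡true⇒T v∈S)) = trans (∧-identityʳ _) (above-w₀ v (S⊆W v (≡true⇒T v∈S)))

    partners-outside-S : S w₀ ≡ false → ∀ v → firstEdgeOK W S w₀ v ≡ (W′ v ∧ not (S v))
    partners-outside-S w₀∉S v rewrite T⇒≡true w₀∈W | w₀∉S with W v in v∈W
    ... | false = ∧-zeroʳ _
    ... | true rewrite above-w₀ v (≡true⇒T v∈W) = refl

    size-without : ∀ k v → size S ≡ suc (suc k) → T (S w₀) → T (S v) → v ≢ w₀ → size (without S w₀ v) ≡ k
    size-without k v e w₀∈S v∈S v≢w₀ = suc-injective (suc-injective (begin
      suc (suc (size (without S w₀ v)))          ≡⟨ cong (suc ∘ suc) (size-cong (λ x → ∧-assoc (S x) _ _)) ⟨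
      suc (suc (size (remove (remove S w₀) v)))  ≡⟨ cong suc (size-remove (remove S w₀) v v∈S-w₀) ⟨
      suc (size (remove S w₀))                   ≡⟨ size-remove S w₀ w₀∈S ⟨
      size S                                     ≡⟨ e ⟩
      suc (suc k)                                ∎))
      where
      v∈S-w₀ : T (remove S w₀ v)
      v∈S-w₀ rewrite ≢⇒==false (v≢w₀ ∘ sym) = subst T (sym (∧-identityʳ (S v))) v∈S

    without-outside : ∀ v → S w₀ ≡ false → S v ≡ false → ∀ x → without S w₀ v x ≡ S x
    without-outside v w₀∉S v∉S x with S x in x∈S
    ... | false = refl
    ... | true rewrite ≢⇒==false {a = w₀} {x} (λ q → ≡false⇒¬T w₀∉S (subst (T ∘ S) (sym q) (≡true⇒T x∈S)))
                     | ≢⇒==false {a = v} {x} (λ q → ≡false⇒¬T v∉S (subst (T ∘ S) (sym q) (≡true⇒T x∈S))) = refl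

    module Partner (v : Fin n) (ok : T (firstEdgeOK W S w₀ v)) where
      v∈W : T (W v)
      v∈W = T-∧-fst (W v) (T-∧-snd (W w₀) (T-∧-snd (toℕ w₀ <ᵇ toℕ v) ok))

      v≢w₀ : v ≢ w₀
      v≢w₀ q = <-irrefl (cong toℕ (sym q)) (<ᵇ⇒< _ _ (T-∧-fst (toℕ w₀ <ᵇ toℕ v) ok))

      same-side : S v ≡ S w₀
      same-side = agree⇒≡ (S w₀) (S v) (T-∧-snd (W v) (T-∧-snd (W w₀) (T-∧-snd (toℕ w₀ <ᵇ toℕ v) ok)))
        where
        agree⇒≡ : ∀ a b → T (agree a b) → b ≡ a
        agree⇒≡ false false _ = refl
        agree⇒≡ true true _ = refl

    -- The inductive step when w₀ ∈ S: w₀ must be matched to one of the other 2j+1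
    -- vertices of S, leaving |W| - 2 vertices and a 2j-set to cover.
    step-least-in-S : ∀ {bound} → ClosedForm bound → ∀ w′ j m → w′ ≤ bound → size W ≡ suc w′ →
      size S ≡ 2 * j → S ⊆ W → S w₀ ≡ true → ncompat W S (suc m) ≡ compat (suc w′) j (suc m)
    step-least-in-S IH w′ zero m w′≤ |W| |S| S⊆W w₀∈S = ⊥-elim (≡false⇒¬T (size-0 S |S| w₀) (≡true⇒T w₀∈S))
    step-least-in-S IH w′ (suc j) m w′≤ |W| |S| S⊆W w₀∈S = begin
      ncompat W S (suc m)
        ≡⟨ ncompat-split m ⟩
      ncompat W′ S (suc m) + sum (byFirstEdge W S m w₀)
        ≡⟨ cong₂ _+_ (ncompat-⊈ W′ S w₀ (suc m) (≡true⇒T w₀∈S) w₀∉W′) (sum-byFirstEdge-w₀ m (compat (w′ ∸ 1) j m) rest) ⟩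
      size (firstEdgeOK W S w₀) * compat (w′ ∸ 1) j m
        ≡⟨ cong (_* compat (w′ ∸ 1) j m) partners ⟩
      suc (2 * j) * compat (w′ ∸ 1) j m ∎
      where
      |S|′ : size S ≡ suc (suc (2 * j))
      |S|′ = trans |S| (2*suc j)
      rest : ∀ v → T (firstEdgeOK W S w₀ v) → ncompat (after W w₀ v) (without S w₀ v) m ≡ compat (w′ ∸ 1) j m
      rest v ok = IH (w′ ∸ 1) (after W w₀ v) (without S w₀ v) j m (≤-trans (m∸n≤m w′ 1) w′≤)
                     (size-after w′ v |W| v∈W v≢w₀) (size-without (2 * j) v |S|′ (≡true⇒T w₀∈S) v∈S v≢w₀)
                     (without⊆after S⊆W v)
        where
        open Partner v ok
        v∈S : T (S v)
        v∈S = ≡true⇒T (trans same-side w₀∈S)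
      partners : size (firstEdgeOK W S w₀) ≡ suc (2 * j)
      partners = trans (size-cong (partners-in-S w₀∈S S⊆W)) (suc-injective (trans (sym (size-remove S w₀ (≡true⇒T w₀∈S))) |S|′))

    -- The inductive step when w₀ ∉ S: w₀ is unmatched, or matched to one of the
    -- |W′| - 2j vertices of W′ outside S.
    step-least-outside-S : ∀ {bound} → ClosedForm bound → ∀ w′ j m → w′ ≤ bound → size W ≡ suc w′ →
      size S ≡ 2 * j → S ⊆ W → S w₀ ≡ false → ncompat W S (suc m) ≡ compat (suc w′) j (suc m)
    step-least-outside-S IH w′ j m w′≤ |W| |S| S⊆W w₀∉S = begin
      ncompat W S (suc m)
        ≡⟨ ncompat-split m ⟩
      ncompat W′ S (suc m) + sum (byFirstEdge W S m w₀)
        ≡⟨ cong₂ _+_ (IH w′ W′ S j (suc m) w′≤ (size-W′ w′ |W|) |S| S⊆W′) (sum-byFirstEdge-w₀ m (compat (w′ ∸ 1) j m) rest) ⟩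
      compat w′ j (suc m) + size (firstEdgeOK W S w₀) * compat (w′ ∸ 1) j m
        ≡⟨ cong (λ z → compat w′ j (suc m) + z * compat (w′ ∸ 1) j m) partners ⟩
      compat w′ j (suc m) + (w′ ∸ 2 * j) * compat (w′ ∸ 1) j m
        ≡⟨ compat-step j m w′ 2j≤w′ ⟩
      compat (suc w′) j (suc m) ∎
      where
      S⊆W′ : S ⊆ W′
      S⊆W′ x x∈S rewrite ≢⇒==false {a = w₀} {x} (λ q → ≡false⇒¬T w₀∉S (subst (T ∘ S) (sym q) x∈S)) =
        subst T (sym (∧-identityʳ (W x))) (S⊆W x x∈S)
      2j≤w′ : 2 * j ≤ w′
      2j≤w′ = subst₂ _≤_ |S| (size-W′ w′ |W|) (size-mono S W′ S⊆W′)
      rest : ∀ v → T (firstEdgeOK W S w₀ v) → ncompat (after W w₀ v) (without S w₀ v) m ≡ compat (w′ ∸ 1) j m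
      rest v ok = IH (w′ ∸ 1) (after W w₀ v) (without S w₀ v) j m (≤-trans (m∸n≤m w′ 1) w′≤)
                     (size-after w′ v |W| v∈W v≢w₀) (trans (size-cong (without-outside v w₀∉S v∉S)) |S|)
                     (without⊆after S⊆W v)
        where
        open Partner v ok
        v∉S : S v ≡ false
        v∉S = trans same-side w₀∉S
      partners : size (firstEdgeOK W S w₀) ≡ w′ ∸ 2 * j
      partners = trans (size-cong (partners-outside-S w₀∉S))
                       (trans (size-∖-subset S W′ S⊆W′) (cong₂ _∸_ (size-W′ w′ |W|) |S|))

  closed-form : ∀ bound → ClosedForm bound
  closed-form bound w W S zero zero _ _ |S| _ = trans (ncompat-0-empty W S |S|) (sym (μ-empty w))
  closed-form bound w W S (suc j) zero _ _ |S| _ = ncompat-0-nonempty W S (suc (2 * j)) (trans |S| (2*suc j))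
  closed-form bound zero W S zero (suc m) _ |W| _ _ = ncompat-emptyW W S m (size-0 W |W|)
  closed-form bound zero W S (suc j) (suc m) _ |W| |S| S⊆W
    with s , s∈S ← size-pos S (subst (0 <_) (sym (trans |S| (2*suc j))) z<s) =
    ⊥-elim (≡false⇒¬T (size-0 W |W| s) (S⊆W s s∈S))
  closed-form zero (suc w′) W S j (suc m) () |W| |S| S⊆W
  closed-form (suc bound) (suc w′) W S j (suc m) w≤ |W| |S| S⊆W
    with x , x∈W ← size-pos W (subst (0 <_) (sym |W|) z<s)
    with w₀ , w₀∈W , least ← minimum W x x∈W
    with S w₀ in w₀∈S
  ... | true = step-least-in-S (closed-form bound) w′ j m (≤-pred w≤) |W| |S| S⊆W w₀∈S
    where open LeastVertex W S w₀ w₀∈W least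
  ... | false = step-least-outside-S (closed-form bound) w′ j m (≤-pred w≤) |W| |S| S⊆W w₀∈S
    where open LeastVertex W S w₀ w₀∈W least

module Solutions where

  open Counting
  open CanonicalMatchings
  open import Data.Bool using (Bool; true; false; _∧_; _∨_; not; T; if_then_else_)
  open import Data.Bool.Properties using (∨-zeroʳ)
  open import Data.Nat using (ℕ; _+_; _≡ᵇ_; _<ᵇ_; NonZero; >-nonZero⁻¹)
  open import Data.Nat.DivMod using (_mod_; m<n⇒m%n≡m)
  open import Data.Fin using (Fin; toℕ; _≟_)
  open import Data.Nat.Properties using (+-identityʳ)
  open import Data.Fin.Properties using (toℕ-injective; toℕ-fromℕ<; toℕ<n)
  open import Data.Product using (_,_)
  open import Data.Vec using (Vec; []; _∷_; lookup; toList; foldr; zipWith)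
  open import Data.Vec.Properties using (lookup∘tabulate)
  open import Data.List.Relation.Unary.Any using (satisfied)
  open import Data.Empty using (⊥-elim)
  open import Data.Unit using (tt)
  open import Function using (_∘_)
  open import Relation.Nullary using (yes; no)
  open import Relation.Nullary.Decidable using (T?)
  open import Relation.Binary.PropositionalEquality

  incident-first : ∀ {n} (u v : Fin n) → incident (u , v) u ≡ true
  incident-first u v with u ≟ u
  ... | yes _ = refl
  ... | no u≢u = ⊥-elim (u≢u refl)

  incident-second : ∀ {n} (u v : Fin n) → incident (u , v) v ≡ true
  incident-second u v with v ≟ v
  ... | yes _ = ∨-zeroʳ _
  ... | no v≢v = ⊥-elim (v≢v refl)

  not-incident : ∀ {n} (u v a : Fin n) → (a == u) ≡ false → (a == v) ≡ false → incident (u , v) a ≡ false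
  not-incident u v a au av with u ≟ a | v ≟ a
  ... | yes refl | _ = ⊥-elim (≡false⇒¬T au (≡true⇒T (==-refl a)))
  ... | no _ | yes refl = ⊥-elim (≡false⇒¬T av (≡true⇒T (==-refl a)))
  ... | no _ | no _ = refl

  module _ {p : ℕ} .{{_ : NonZero p}} where

    toℕ-0ₚ : toℕ (0ₚ {p}) ≡ 0
    toℕ-0ₚ = trans (toℕ-fromℕ< _) (m<n⇒m%n≡m (>-nonZero⁻¹ p))

    toℕ-mod : (a : Fin p) → toℕ a mod p ≡ a
    toℕ-mod a = toℕ-injective (trans (toℕ-fromℕ< _) (m<n⇒m%n≡m (toℕ<n a)))

    +ₚ-identityʳ : (a : Fin p) → a +ₚ 0ₚ ≡ a
    +ₚ-identityʳ a = trans (cong (λ z → (toℕ a + z) mod p) toℕ-0ₚ)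
                           (trans (cong (_mod p) (+-identityʳ (toℕ a))) (toℕ-mod a))

    +ₚ-identityˡ : (a : Fin p) → 0ₚ +ₚ a ≡ a
    +ₚ-identityˡ a = trans (cong (λ z → (z + toℕ a) mod p) toℕ-0ₚ) (toℕ-mod a)

    column : ∀ {n m} → Vec (Edge n) m → Vec (Fin p) m → Fin n → Fin p
    column es z a = foldr _ _+ₚ_ 0ₚ (zipWith (λ e zₑ → if incident e a then zₑ else 0ₚ) es z)

    column-uncovered : ∀ {n m} (es : Vec (Edge n) m) (z : Vec (Fin p) m) (a : Fin n) →
      covered a es ≡ false → column es z a ≡ 0ₚ
    column-uncovered [] [] a _ = refl
    column-uncovered ((u , v) ∷ es) (z₀ ∷ z) a unc
      with a == u in au | a == v in av
    ... | false | false rewrite not-incident u v a au av = trans (+ₚ-identityˡ _) (column-uncovered es z a unc)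

    column-first : ∀ {n m} (u v : Fin n) (es : Vec (Edge n) m) (z₀ : Fin p) (z : Vec (Fin p) m) (a : Fin n) →
      incident (u , v) a ≡ true → covered a es ≡ false → column ((u , v) ∷ es) (z₀ ∷ z) a ≡ z₀
    column-first u v es z₀ z a inc unc rewrite inc =
      trans (cong (z₀ +ₚ_) (column-uncovered es z a unc)) (+ₚ-identityʳ z₀)

    column-rest : ∀ {n m} (u v : Fin n) (es : Vec (Edge n) m) (z₀ : Fin p) (z : Vec (Fin p) m) (a : Fin n) →
      (a == u) ≡ false → (a == v) ≡ false → column ((u , v) ∷ es) (z₀ ∷ z) a ≡ column es z a
    column-rest u v es z₀ z a au av rewrite not-incident u v a au av = +ₚ-identityˡ _

    nonzero : Fin p → Bool
    nonzero c = not (toℕ c ≡ᵇ 0)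

    support : ∀ {n} → Vec (Fin p) n → Sub n
    support x i = nonzero (lookup x i)

    -- Both ends of an edge e receive the same value z_e, so a solution X = Mᵀz of a
    -- matching is zero at both ends of each edge or at neither.
    respects-solution : ∀ {n m} (es : Vec (Edge n) m) (z : Vec (Fin p) m) (X : Fin n → Fin p) →
      T (isMatching es) → (∀ a → T (covered a es) → X a ≡ column es z a) → T (respects (nonzero ∘ X) es)
    respects-solution [] [] X _ _ = tt
    respects-solution ((u , v) ∷ es) (z₀ ∷ z) X matching X≡ =
      T-∧-intro first-edge (respects-solution es z X (T-∧-snd B rest) X≡′)
      where
      B : Bool
      B = allIn (beyond u v) es
      rest : T (B ∧ isMatching es)
      rest = T-∧-snd (toℕ u <ᵇ toℕ v) (subst T (isMatching-cons u v es) matching)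
      avoids : ∀ a → beyond u v ⊆ (λ x → not (a == x)) → covered a es ≡ false
      avoids a sub = T-not⇒≡false (subst T (sym (uncovered⇔avoided a es)) (allIn-mono es sub (T-∧-fst B rest)))
      u-free : covered u es ≡ false
      u-free = avoids u (λ x t → <ᵇ⇒≢ᵇ (toℕ u) (toℕ x) (T-∧-fst (toℕ u <ᵇ toℕ x) t))
      v-free : covered v es ≡ false
      v-free = avoids v (λ x t → T-∧-snd (toℕ u <ᵇ toℕ x) t)
      first-edge : T (agree (nonzero (X u)) (nonzero (X v)))
      first-edge rewrite X≡ u (covered-first u v es) | X≡ v (covered-second u v es)
                       | column-first u v es z₀ z u (incident-first u v) u-free
                       | column-first u v es z₀ z v (incident-second u v) v-free = agree-refl (nonzero z₀)
      X≡′ : ∀ a → T (covered a es) → X a ≡ column es z a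
      X≡′ a cov = trans (X≡ a (covered-later a (u , v) es cov)) (column-rest u v es z₀ z a (off u u-free) (off v v-free))
        where
        off : ∀ b → covered b es ≡ false → (a == b) ≡ false
        off b free = ¬T⇒≡false λ a≡b → ≡false⇒¬T free (subst (λ c → T (covered c es)) (==⇒≡ {a = a} {b} a≡b) cov)

    covers-solution : ∀ {n m} (es : Vec (Edge n) m) (z : Vec (Fin p) m) (X : Fin n → Fin p) →
      (∀ a → X a ≡ column es z a) → T (covers (nonzero ∘ X) es)
    covers-solution es z X X≡ = every-intro _ covered-or-zero
      where
      covered-or-zero : ∀ s → T (not (nonzero (X s)) ∨ covered s es)
      covered-or-zero s with covered s es in cov
      ... | true = subst T (sym (∨-zeroʳ _)) tt
      ... | false rewrite X≡ s | column-uncovered es z s cov | toℕ-0ₚ = tt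

    solvable⇒compatible : ∀ {n m} (x : Vec (Fin p) n) (es : Vec (Edge n) m) → T (isMatching es) → Solvable x es →
      T (Compatible (λ _ → true) (support x) es)
    solvable⇒compatible x es matching sol with z , Mᵀz≡x ← satisfied sol =
      T-∧-intro matching (T-∧-intro (allIn-everywhere es)
        (T-∧-intro (respects-solution es z X matching (λ a _ → X≡ a)) (covers-solution es z X X≡)))
      where
      X : Fin _ → Fin p
      X = lookup x
      X≡ : ∀ a → X a ≡ column es z a
      X≡ a = trans (sym (cong (λ y → lookup y a) Mᵀz≡x)) (lookup∘tabulate _ a)

    weight≡size-support : ∀ {n} (x : Vec (Fin p) n) → weight x ≡ size (support x)
    weight≡size-support x = trans (count-filter (T? ∘ nonzero) (toList x)) (count-support x)
      where
      count-support : ∀ {n} (x : Vec (Fin p) n) → count nonzero (toList x) ≡ size (support x)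
      count-support [] = refl
      count-support (a ∷ x) = cong (ind (nonzero a) +_) (count-support x)

open MatchingNumbers
open Counting
open CanonicalMatchings
open CompatibleMatchings
open Solutions
open import Data.Bool using (true; false; _∧_)
open import Data.Bool.Properties using (∧-identityʳ)
open import Data.Nat.Properties using (≤-refl; *-monoˡ-≤; module ≤-Reasoning)
open import Relation.Nullary using (does)
open import Data.List using (List)
open import Relation.Nullary.Decidable using (T?)
open import Function using (_∘_)
open import Relation.Binary.PropositionalEquality using (refl; sym; trans; cong; cong₂; subst)

goodCount≤ncompat : ∀ {p} .{{_ : NonZero p}} (n m : ℕ) (x : Vec (Fin p) n) →
  goodCount n m x ≤ ncompat (λ _ → true) (support x) m
goodCount≤ncompat n m x = subst (_≤ ncompat (λ _ → true) (support x) m)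
  (sym (trans (count-filter (solvable? x) (matchings n m)) (count-filterᵇ (λ es → does (solvable? x es)) isMatching AV)))
  (count-mono AV (λ es t → solvable⇒compatible x es (T-∧-fst (isMatching es) t)
                             (witness (solvable? x es) (T-∧-snd (isMatching es) t))))
  where
  AV : List (Vec (Edge n) m)
  AV = allVecs (allEdges n) m

-- All m-matchings are compatible with S = ∅, so the closed form counts them.
totalCount≡μ : ∀ n m → totalCount n m ≡ μ n m
totalCount≡μ n m = trans (count-filter (T? ∘ isMatching) AV) (trans (sumL-cong AV (cong ind ∘ matching≡compatible-∅))
  (closed-form n n (λ _ → true) (λ _ → false) 0 m ≤-refl (size-full n) (size-∅ n) (λ _ ())))
  where
  AV : List (Vec (Edge n) m)
  AV = allVecs (allEdges n) m
  matching≡compatible-∅ : ∀ es → isMatching es ≡ Compatible (λ _ → true) (λ _ → false) es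
  matching≡compatible-∅ es = sym (trans
    (cong₂ (λ a b → isMatching es ∧ (a ∧ b)) (T⇒≡true (allIn-everywhere es))
           (cong₂ _∧_ (respects-∅ es) (T⇒≡true (every-intro {n} (λ _ → true) (λ _ → _)))))
    (∧-identityʳ (isMatching es)))

lemma3p3 : (p n m : ℕ) → .{{_ : NonZero p}} → 2 ≤ p → 1 ≤ n → 1 ≤ m → 2 * m ≤ n →
           (x : Vec (Fin p) n) (k j : ℕ) → k ≡ 2 * j → weight x ≡ k →
           goodCount n m x * (n C k) ≤ (m C j) * totalCount n m
lemma3p3 p n m _ _ _ _ x k j refl |x| = begin
  goodCount n m x * (n C (2 * j))
    ≤⟨ *-monoˡ-≤ (n C (2 * j)) (goodCount≤ncompat n m x) ⟩
  ncompat (λ _ → true) (support x) m * (n C (2 * j))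
    ≡⟨ cong₂ _*_ (closed-form n n (λ _ → true) (support x) j m ≤-refl (size-full n) |S| (λ _ _ → _))
                 (sym (binom≡C n (2 * j))) ⟩
  compat n j m * binom n (2 * j)
    ≡⟨ compat-double-count n j m (subst (_≤ n) |S| (size-≤ (support x))) ⟩
  binom m j * μ n m
    ≡⟨ cong₂ _*_ (binom≡C m j) (sym (totalCount≡μ n m)) ⟩
  (m C j) * totalCount n m ∎
  where
  open ≤-Reasoning
  |S| : size (support x) ≡ 2 * j
  |S| = trans (sym (weight≡size-support x)) |x|
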